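{- Let $G$ be a finite simple $d$-regular Vizing-class-2 graph. Then \[\eta'_{p}(G)\leq \frac{(2^{\lceil \log_2 (d+1)\rceil})^2+2}{3}=\frac{(2^{\lceil \log_2 \chi'(G)\rceil})^2+2}{3}.\] In particular, if $d+1=2^n$ for some $n>0$, then $\eta'_{p}(G)\leq \frac{(d+1)^2+2}{3}=\frac{(\chi'(G))^2+2}{3}$.
   Context: A $d$-regular graph is Vizing-class-2 if its chromatic index $\chi'(G)$ equals $d+1$. For an edge $e$, $N'(e)$ is the set of edges other than $e$ sharing an endpoint with $e$. A proper additive edge coloring is a proper edge coloring $c:E(G)\to\mathbb{N}$ such that for any two edges $e_1,e_2$ sharing an endpoint, $\sum_{e\in N'(e_1)}c(e)\neq\sum_{e\in N'(e_2)}c(e)$. $\eta_p'(G)$ is the least $k$ such that $G$ has a proper additive edge coloring with labels in $\{1,\ldots,k\}$. -}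

module Defs where

open import Data.Nat using (ℕ; zero; suc; _+_; _*_; _≤_; _^_; _/_)
open import Data.Nat.Logarithm using (⌈log₂_⌉)
open import Data.Bool using (Bool; true; false; if_then_else_; _∧_; not)
open import Data.Fin using (Fin; _≟_)
open import Data.List using (List; map; allFin)
open import Data.Nat.ListAction using (sum)
open import Data.Product using (Σ; _×_; ∃)
open import Relation.Nullary using (¬_; does)
open import Relation.Binary.PropositionalEquality using (_≡_; _≢_)

record SimpleGraph (n : ℕ) : Set where
  field
    adj   : Fin n → Fin n → Bool
    sym   : ∀ u v → adj u v ≡ adj v u
    irref : ∀ u → adj u u ≡ false
open SimpleGraph public

Adj : ∀ {n} → SimpleGraph n → Fin n → Fin n → Set
Adj G u v = adj G u v ≡ true

Σv : ∀ {n} → (Fin n → ℕ) → ℕ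
Σv {n} f = sum (map f (allFin n))

degree : ∀ {n} → SimpleGraph n → Fin n → ℕ
degree G u = Σv (λ w → if adj G u w then 1 else 0)

Regular : ∀ {n} → SimpleGraph n → ℕ → Set
Regular G d = ∀ u → degree G u ≡ d

-- An edge labelling: a label for every ordered pair, required to be
-- symmetric on edges (so it is a function on the undirected edge set);
-- values on non-adjacent pairs are irrelevant.
Labelling : ℕ → Set
Labelling n = Fin n → Fin n → ℕ

WellDefined : ∀ {n} → SimpleGraph n → Labelling n → Set
WellDefined G c = ∀ u v → Adj G u v → c u v ≡ c v u

InRange : ∀ {n} → SimpleGraph n → Labelling n → ℕ → Set
InRange G c k = ∀ u v → Adj G u v → (1 ≤ c u v) × (c u v ≤ k)

Proper : ∀ {n} → SimpleGraph n → Labelling n → Set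
Proper G c = ∀ u v w → Adj G u v → Adj G u w → v ≢ w → c u v ≢ c u w

sumAtExcept : ∀ {n} → SimpleGraph n → Labelling n → Fin n → Fin n → ℕ
sumAtExcept G c u v =
  Σv (λ w → if adj G u w ∧ not (does (w ≟ v)) then c u w else 0)

neighbourSum : ∀ {n} → SimpleGraph n → Labelling n → Fin n → Fin n → ℕ
neighbourSum G c u v = sumAtExcept G c u v + sumAtExcept G c v u

Additive : ∀ {n} → SimpleGraph n → Labelling n → Set
Additive G c = ∀ u v w → Adj G u v → Adj G u w → v ≢ w →
  neighbourSum G c u v ≢ neighbourSum G c u w

HasProperEdgeColouring : ∀ {n} → SimpleGraph n → ℕ → Set
HasProperEdgeColouring {n} G k =
  Σ (Labelling n) λ c → WellDefined G c × InRange G c k × Proper G c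

ChromaticIndex : ∀ {n} → SimpleGraph n → ℕ → Set
ChromaticIndex G m =
  HasProperEdgeColouring G m × (∀ k → HasProperEdgeColouring G k → m ≤ k)

VizingClass2 : ∀ {n} → SimpleGraph n → ℕ → Set
VizingClass2 G d = Regular G d × ChromaticIndex G (suc d)

-- G has a proper additive edge colouring with labels in {1,…,k},
-- i.e. η'_p(G) ≤ k
HasProperAdditiveColouring : ∀ {n} → SimpleGraph n → ℕ → Set
HasProperAdditiveColouring {n} G k =
  Σ (Labelling n) λ c →
    WellDefined G c × InRange G c k × Proper G c × Additive G c

-- ((2^⌈log₂ m⌉)^2 + 2) / 3   (an exact division)
bound : ℕ → ℕ
bound m = ((2 ^ ⌈log₂ m ⌉) ^ 2 + 2) / 3

-- Take a proper edge colouring c of G with colours 0, …, d. Since G is d-regular, exactly one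
-- colour m_v is missing at each vertex v, so for any weight w the w-labels at v sum to
-- P − w(m_v), where P = w(0) + … + w(d). Relabelling every edge e by w(c(e)), the neighbour sum
-- of an edge uv is then (sum of labels at u) + P − (w(m_v) + 2·w(c(uv))), so two edges uv, uv′
-- at u can only have equal neighbour sums if w(m_v) + 2·w(c(uv)) = w(m_v′) + 2·w(c(uv′)).
-- Take w(i) = 1 + spread(i), where spread reads the binary digits of i in base 4: the base-4
-- digits of spread(a) + 2·spread(b) are the pairs of bits of a and b, so that equation forces
-- c(uv) = c(uv′), contradicting properness. With K = ⌈log₂(d+1)⌉ bits, spread(i) ≤ (4^K − 1)/3,
-- which gives the bound.

module Submission where

open import Level using (Level)
open import Data.Bool using (Bool; true; false; if_then_else_; _∧_; not)
open import Data.Bool.Properties using (∧-identityʳ; ∧-zeroʳ)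
import Data.Bool as Bool
open import Data.Fin using (Fin; _≟_)
open import Data.List using (List; []; _∷_; [_]; _++_; map; filter; length; allFin; upTo)
open import Data.List.Properties
  using (length-++; length-map; length-upTo; map-++; map-∘; map-cong-local)
open import Data.List.Membership.Propositional using (_∈_)
open import Data.List.Membership.Propositional.Properties
  using (∈-∃++; ∈-allFin; ∈-filter⁻; ∈-map⁻; ∈-upTo⁺)
open import Data.List.Relation.Binary.Subset.Propositional using (_⊆_)
open import Data.List.Relation.Binary.Permutation.Propositional
  using (_↭_; ↭-refl; ↭-sym; ↭-trans; prep)
open import Data.List.Relation.Binary.Permutation.Propositional.Properties
  using (∈-resp-↭; ↭-length)
import Data.List.Relation.Binary.Permutation.Propositional.Properties as ↭
open import Data.List.Relation.Unary.All as All using (All; []; _∷_)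
import Data.List.Relation.Unary.All.Properties as Allₚ
open import Data.List.Relation.Unary.Any using (here; there; tail)
open import Data.List.Relation.Unary.AllPairs using ([]; _∷_)
open import Data.List.Relation.Unary.Unique.Propositional using (Unique)
open import Data.List.Relation.Unary.Unique.Propositional.Properties using (allFin⁺; filter⁺)
open import Data.Nat hiding (_≟_)
open import Data.Nat.DivMod
open import Data.Nat.ListAction using (sum)
open import Data.Nat.ListAction.Properties using (sum-++; sum-↭)
open import Data.Nat.Logarithm using (⌈log₂_⌉; ⌈log₂2^n⌉≡n)
open import Data.Nat.Logarithm.Core using (⌈log2⌉)
open import Data.Nat.Properties hiding (_≟_)
open import Data.Nat.Tactic.RingSolver using (solve-∀)
open import Data.Product using (∃; _×_; _,_; proj₁; proj₂)
open import Function using (_∘_)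
open import Induction.WellFounded using (Acc; acc)
open import Relation.Binary.PropositionalEquality
  using (_≡_; _≢_; refl; sym; trans; cong; cong₂; subst; module ≡-Reasoning)
open import Relation.Unary using (Decidable)
open import Relation.Nullary.Decidable using (does; dec-true; dec-false)
open import Defs hiding (sym)

divMod-unique : ∀ n .{{_ : NonZero n}} {r r′ q q′} → r < n → r′ < n →
                r + q * n ≡ r′ + q′ * n → r ≡ r′ × q ≡ q′
divMod-unique n {r} {r′} {q} {q′} r<n r′<n eq = r≡r′ , q≡q′
  where
  open ≡-Reasoning
  r≡r′ : r ≡ r′
  r≡r′ = begin
    r                  ≡⟨ m<n⇒m%n≡m r<n ⟨
    r % n              ≡⟨ [m+kn]%n≡m%n r q n ⟨
    (r + q * n) % n    ≡⟨ cong (_% n) eq ⟩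
    (r′ + q′ * n) % n  ≡⟨ [m+kn]%n≡m%n r′ q′ n ⟩
    r′ % n             ≡⟨ m<n⇒m%n≡m r′<n ⟩
    r′                 ∎
  q≡q′ : q ≡ q′
  q≡q′ = *-cancelʳ-≡ q q′ n (+-cancelˡ-≡ r _ _ (trans eq (cong (_+ q′ * n) (sym r≡r′))))

r+q*n<m*n : ∀ {m n q r} → r < n → q < m → r + q * n < m * n
r+q*n<m*n {m} {n} {q} {r} r<n q<m = begin-strict
  r + q * n  <⟨ +-monoˡ-< (q * n) r<n ⟩
  suc q * n  ≤⟨ *-monoˡ-≤ n q<m ⟩
  m * n      ∎
  where open ≤-Reasoning

n≤2*⌈n/2⌉ : ∀ n → n ≤ 2 * ⌈ n /2⌉
n≤2*⌈n/2⌉ n = begin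
  n                     ≡⟨ ⌊n/2⌋+⌈n/2⌉≡n n ⟨
  ⌊ n /2⌋ + ⌈ n /2⌉     ≤⟨ +-monoˡ-≤ ⌈ n /2⌉ (⌊n/2⌋≤⌈n/2⌉ n) ⟩
  ⌈ n /2⌉ + ⌈ n /2⌉     ≡⟨ cong (⌈ n /2⌉ +_) (+-identityʳ ⌈ n /2⌉) ⟨
  2 * ⌈ n /2⌉           ∎
  where open ≤-Reasoning

n≤2^⌈log2⌉n : ∀ n (rec : Acc _<_ n) → n ≤ 2 ^ ⌈log2⌉ n rec
n≤2^⌈log2⌉n zero          _         = z≤n
n≤2^⌈log2⌉n (suc zero)    _         = s≤s z≤n
n≤2^⌈log2⌉n (suc (suc n)) (acc rec) = begin
  2 + n            ≤⟨ +-monoʳ-≤ 2 (n≤2*⌈n/2⌉ n) ⟩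
  2 + 2 * ⌈ n /2⌉  ≡⟨ *-suc 2 ⌈ n /2⌉ ⟨
  2 * suc ⌈ n /2⌉  ≤⟨ *-monoʳ-≤ 2 (n≤2^⌈log2⌉n (suc ⌈ n /2⌉) _) ⟩
  2 ^ ⌈log2⌉ (2 + n) (acc rec) ∎
  where open ≤-Reasoning

n≤2^⌈log₂n⌉ : ∀ n → n ≤ 2 ^ ⌈log₂ n ⌉
n≤2^⌈log₂n⌉ n = n≤2^⌈log2⌉n n _

Separating : ℕ → (ℕ → ℕ) → Set
Separating k w = ∀ {a a′ b b′} → b < k → b′ < k → w a + w b * 2 ≡ w a′ + w b′ * 2 → b ≡ b′

Separating-antimono : ∀ {j k w} → j ≤ k → Separating k w → Separating j w
Separating-antimono j≤k sep b<j b′<j = sep (≤-trans b<j j≤k) (≤-trans b′<j j≤k)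

Separating-suc : ∀ {k w} → Separating k w → Separating k (suc ∘ w)
Separating-suc {w = w} sep {a} {a′} {b} {b′} b<k b′<k eq =
  sep b<k b′<k
    (+-cancelˡ-≡ 3 _ _ (trans (shift (w a) (w b)) (trans eq (sym (shift (w a′) (w b′))))))
  where
  shift : ∀ p q → 3 + (p + q * 2) ≡ suc p + suc q * 2
  shift = solve-∀

spread : ℕ → ℕ → ℕ
spread zero    x = 0
spread (suc k) x = x % 2 + spread k (x / 2) * 4

spread-separating : ∀ k → Separating (2 ^ k) (spread k)
spread-separating zero    b<1 b′<1 _ = trans (n<1⇒n≡0 b<1) (sym (n<1⇒n≡0 b′<1))
spread-separating (suc k) {a} {a′} {b} {b′} b<2^1+k b′<2^1+k eq = begin
  b                    ≡⟨ m≡m%n+[m/n]*n b 2 ⟩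
  b % 2 + b / 2 * 2    ≡⟨ cong₂ (λ r q → r + q * 2) low high ⟩
  b′ % 2 + b′ / 2 * 2  ≡⟨ m≡m%n+[m/n]*n b′ 2 ⟨
  b′                   ∎
  where
  open ≡-Reasoning
  regroup : ∀ x y → spread (suc k) x + spread (suc k) y * 2
                  ≡ (x % 2 + y % 2 * 2) + (spread k (x / 2) + spread k (y / 2) * 2) * 4
  regroup x y = interleave (x % 2) (y % 2) (spread k (x / 2)) (spread k (y / 2))
    where
    interleave : ∀ r s p q → (r + p * 4) + (s + q * 4) * 2 ≡ (r + s * 2) + (p + q * 2) * 4
    interleave = solve-∀
  digit<4 : ∀ x y → x % 2 + y % 2 * 2 < 4
  digit<4 x y = r+q*n<m*n (m%n<n x 2) (m%n<n y 2)
  half< : ∀ {x} → x < 2 ^ suc k → x / 2 < 2 ^ k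
  half< {x} x< = m<n*o⇒m/o<n (subst (x <_) (*-comm 2 (2 ^ k)) x<)
  digits : a % 2 + b % 2 * 2 ≡ a′ % 2 + b′ % 2 * 2
         × spread k (a / 2) + spread k (b / 2) * 2 ≡ spread k (a′ / 2) + spread k (b′ / 2) * 2
  digits = divMod-unique 4 (digit<4 a b) (digit<4 a′ b′)
                         (trans (sym (regroup a b)) (trans eq (regroup a′ b′)))
  low : b % 2 ≡ b′ % 2
  low = proj₂ (divMod-unique 2 (m%n<n a 2) (m%n<n a′ 2) (proj₁ digits))
  high : b / 2 ≡ b′ / 2
  high = spread-separating k (half< b<2^1+k) (half< b′<2^1+k) (proj₂ digits)

spread*3<4^k : ∀ k x → spread k x * 3 < 4 ^ k
spread*3<4^k zero    x = s≤s z≤n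
spread*3<4^k (suc k) x = begin-strict
  (x % 2 + spread k (x / 2) * 4) * 3      ≡⟨ distrib (x % 2) (spread k (x / 2)) ⟩
  x % 2 * 3 + spread k (x / 2) * 3 * 4    <⟨ r+q*n<m*n bit*3<4 (spread*3<4^k k (x / 2)) ⟩
  4 ^ k * 4                               ≡⟨ *-comm (4 ^ k) 4 ⟩
  4 ^ suc k                               ∎
  where
  open ≤-Reasoning
  distrib : ∀ r s → (r + s * 4) * 3 ≡ r * 3 + s * 3 * 4
  distrib = solve-∀
  bit*3<4 : x % 2 * 3 < 4
  bit*3<4 = s≤s (*-monoˡ-≤ 3 (≤-pred (m%n<n x 2)))

[2^k]^2≡4^k : ∀ k → (2 ^ k) ^ 2 ≡ 4 ^ k
[2^k]^2≡4^k k = trans (^-*-assoc 2 k 2) (trans (cong (2 ^_) (*-comm k 2)) (sym (^-*-assoc 2 2 k)))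

suc-spread≤ : ∀ k x → suc (spread k x) ≤ ((2 ^ k) ^ 2 + 2) / 3
suc-spread≤ k x = begin
  suc y                   ≡⟨ m*n/n≡m (suc y) 3 ⟨
  suc y * 3 / 3           ≤⟨ /-monoˡ-≤ 3 [1+y]*3≤4^k+2 ⟩
  (4 ^ k + 2) / 3         ≡⟨ cong (λ t → (t + 2) / 3) ([2^k]^2≡4^k k) ⟨
  ((2 ^ k) ^ 2 + 2) / 3   ∎
  where
  open ≤-Reasoning
  y : ℕ
  y = spread k x
  [1+y]*3≤4^k+2 : suc y * 3 ≤ 4 ^ k + 2
  [1+y]*3≤4^k+2 = subst (_≤ 4 ^ k + 2) (+-comm (suc (y * 3)) 2) (+-monoˡ-≤ 2 (spread*3<4^k k x))

private variable
  a b p : Level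
  A : Set a
  B : Set b
  xs ys : List A

Unique-map⁺ : {P : A → Set p} {f : A → B} → (∀ {x y} → P x → P y → x ≢ y → f x ≢ f y) →
              All P xs → Unique xs → Unique (map f xs)
Unique-map⁺ inj []         []         = []
Unique-map⁺ inj (px ∷ pxs) (x∉ ∷ uxs) =
  Allₚ.map⁺ (All.zipWith (λ (py , x≢y) → inj px py x≢y) (pxs , x∉)) ∷ Unique-map⁺ inj pxs uxs

∈⇒↭∷ : ∀ {x : A} → x ∈ ys → ∃ λ zs → ys ↭ x ∷ zs
∈⇒↭∷ x∈ys with as , bs , refl ← ∈-∃++ x∈ys = as ++ bs , ↭.shift _ as bs

Unique-⊆⇒++↭ : Unique xs → xs ⊆ ys → ∃ λ zs → xs ++ zs ↭ ys
Unique-⊆⇒++↭ {ys = ys} [] _ = ys , ↭-refl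
Unique-⊆⇒++↭ {xs = x ∷ xs} (x∉ ∷ uxs) xs⊆ys with rest , ys↭x∷rest ← ∈⇒↭∷ (xs⊆ys (here refl)) =
  let zs , xs++zs↭rest = Unique-⊆⇒++↭ uxs xs⊆rest
  in  zs , ↭-trans (prep x xs++zs↭rest) (↭-sym ys↭x∷rest)
  where
  xs⊆rest : xs ⊆ rest
  xs⊆rest y∈xs = tail (All.lookup x∉ y∈xs ∘ sym) (∈-resp-↭ ys↭x∷rest (xs⊆ys (there y∈xs)))

missing-element : (f : A → ℕ) → Unique xs → xs ⊆ ys → suc (length xs) ≡ length ys →
                  ∃ λ m → sum (map f xs) + f m ≡ sum (map f ys)
missing-element {xs = xs} {ys = ys} f uxs xs⊆ys len
  with zs , xs++zs↭ys ← Unique-⊆⇒++↭ uxs xs⊆ys =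
  single zs xs++zs↭ys (+-cancelˡ-≡ (length xs) _ _ (begin
    length xs + length zs  ≡⟨ length-++ xs ⟨
    length (xs ++ zs)      ≡⟨ ↭-length xs++zs↭ys ⟩
    length ys              ≡⟨ len ⟨
    suc (length xs)        ≡⟨ +-comm 1 (length xs) ⟩
    length xs + 1          ∎))
  where
  open ≡-Reasoning
  single : ∀ zs → xs ++ zs ↭ ys → length zs ≡ 1 → ∃ λ m → sum (map f xs) + f m ≡ sum (map f ys)
  single (m ∷ []) xs++m↭ys _ = m , (begin
    sum (map f xs) + f m           ≡⟨ cong (sum (map f xs) +_) (+-identityʳ (f m)) ⟨
    sum (map f xs) + sum [ f m ]   ≡⟨ sum-++ (map f xs) [ f m ] ⟨
    sum (map f xs ++ [ f m ])      ≡⟨ cong sum (map-++ f xs [ m ]) ⟨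
    sum (map f (xs ++ [ m ]))      ≡⟨ sum-↭ (↭.map⁺ f xs++m↭ys) ⟩
    sum (map f ys)                 ∎)

sum-map-if : ∀ (p : A → Bool) (f : A → ℕ) xs →
             sum (map (λ x → if p x then f x else 0) xs)
               ≡ sum (map f (filter (λ x → p x Bool.≟ true) xs))
sum-map-if p f []       = refl
sum-map-if p f (x ∷ xs) with p x
... | true  = cong (f x +_) (sum-map-if p f xs)
... | false = sum-map-if p f xs

sum-map-const : ∀ c (xs : List A) → sum (map (λ _ → c) xs) ≡ length xs * c
sum-map-const c []       = refl
sum-map-const c (x ∷ xs) = cong (c +_) (sum-map-const c xs)

sum-map-update : ∀ {f g : A → ℕ} {v} → (∀ {x} → x ≢ v → f x ≡ g x) → Unique xs → v ∈ xs →
                 sum (map f xs) + g v ≡ sum (map g xs) + f v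
sum-map-update {xs = v ∷ xs} {f} {g} agree (v∉ ∷ _) (here refl) =
  trans (cong (λ s → f v + s + g v) (cong sum (map-cong-local (All.map (agree ∘ (_∘ sym)) v∉))))
        (swap (f v) (sum (map g xs)) (g v))
  where
  swap : ∀ p q r → p + q + r ≡ r + q + p
  swap = solve-∀
sum-map-update {xs = x ∷ xs} {f} {g} {v} agree (x∉ ∷ uxs) (there v∈xs) = begin
  f x + sum (map f xs) + g v
    ≡⟨ +-assoc (f x) _ _ ⟩
  f x + (sum (map f xs) + g v)
    ≡⟨ cong₂ _+_ (agree (All.lookup x∉ v∈xs)) (sum-map-update agree uxs v∈xs) ⟩
  g x + (sum (map g xs) + f v)
    ≡⟨ +-assoc (g x) _ _ ⟨
  g x + sum (map g xs) + f v ∎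
  where open ≡-Reasoning

adj? : ∀ {n} (G : SimpleGraph n) u → Decidable (Adj G u)
adj? G u v = adj G u v Bool.≟ true

neighbours : ∀ {n} → SimpleGraph n → Fin n → List (Fin n)
neighbours {n} G u = filter (adj? G u) (allFin n)

labelSum : ∀ {n} → SimpleGraph n → Labelling n → Fin n → ℕ
labelSum G c u = Σv (λ v → if adj G u v then c u v else 0)

relabel : ∀ {n} → (ℕ → ℕ) → Labelling n → Labelling n
relabel w c u v = w (c u v)

labelSum≡sum-neighbours : ∀ {n} (G : SimpleGraph n) c u →
                          labelSum G c u ≡ sum (map (c u) (neighbours G u))
labelSum≡sum-neighbours G c u = sum-map-if (adj G u) (c u) (allFin _)

degree≡length-neighbours : ∀ {n} (G : SimpleGraph n) u → degree G u ≡ length (neighbours G u)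
degree≡length-neighbours G u =
  trans (sum-map-if (adj G u) (λ _ → 1) (allFin _))
        (trans (sum-map-const 1 (neighbours G u)) (*-identityʳ _))

sumAtExcept+label≡labelSum : ∀ {n} (G : SimpleGraph n) c {u v} → Adj G u v →
                             sumAtExcept G c u v + c u v ≡ labelSum G c u
sumAtExcept+label≡labelSum {n} G c {u} {v} uv = begin
  sumAtExcept G c u v + c u v
    ≡⟨ cong (λ b → sumAtExcept G c u v + (if b then c u v else 0)) uv ⟨
  sumAtExcept G c u v + (if adj G u v then c u v else 0)
    ≡⟨ sum-map-update off-v (allFin⁺ _) (∈-allFin v) ⟩
  labelSum G c u + (if adj G u v ∧ not (does (v ≟ v)) then c u v else 0)
    ≡⟨ cong (labelSum G c u +_) at-v ⟩
  labelSum G c u + 0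
    ≡⟨ +-identityʳ _ ⟩
  labelSum G c u ∎
  where
  open ≡-Reasoning
  term : Fin n → Bool → ℕ
  term w b = if adj G u w ∧ not b then c u w else 0
  off-v : ∀ {w} → w ≢ v → term w (does (w ≟ v)) ≡ (if adj G u w then c u w else 0)
  off-v {w} w≢v = trans (cong (term w) (dec-false (w ≟ v) w≢v))
                        (cong (λ b → if b then c u w else 0) (∧-identityʳ (adj G u w)))
  at-v : term v (does (v ≟ v)) ≡ 0
  at-v = trans (cong (term v) (dec-true (v ≟ v) refl))
               (cong (λ b → if b then c u v else 0) (∧-zeroʳ (adj G u v)))

module _ {n} (G : SimpleGraph n) {d} (regular : Regular G d) {c : Labelling n}
         (c-sym : WellDefined G c) (c<1+d : ∀ u v → Adj G u v → c u v < suc d)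
         (c-proper : Proper G c) (w : ℕ → ℕ) where

  missing-colour : ∀ u → ∃ λ m → labelSum G (relabel w c) u + w m ≡ sum (map w (upTo (suc d)))
  missing-colour u =
    let m , missing = missing-element w unique colours⊆ len
    in  m , trans (cong (_+ w m) sum≡) missing
    where
    colours : List ℕ
    colours = map (c u) (neighbours G u)
    sum≡ : labelSum G (relabel w c) u ≡ sum (map w colours)
    sum≡ = trans (labelSum≡sum-neighbours G (relabel w c) u) (cong sum (map-∘ (neighbours G u)))
    unique : Unique colours
    unique = Unique-map⁺ (c-proper u _ _) (Allₚ.all-filter (adj? G u) (allFin n))
                         (filter⁺ (adj? G u) (allFin⁺ n))
    colours⊆ : colours ⊆ upTo (suc d)
    colours⊆ i∈ with v , v∈ , refl ← ∈-map⁻ (c u) {xs = neighbours G u} i∈ =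
      ∈-upTo⁺ (c<1+d u v (proj₂ (∈-filter⁻ (adj? G u) {xs = allFin n} v∈)))
    len : suc (length colours) ≡ length (upTo (suc d))
    len = begin
      suc (length colours)              ≡⟨ cong suc (length-map (c u) (neighbours G u)) ⟩
      suc (length (neighbours G u))     ≡⟨ cong suc (degree≡length-neighbours G u) ⟨
      suc (degree G u)                  ≡⟨ cong suc (regular u) ⟩
      suc d                             ≡⟨ length-upTo (suc d) ⟨
      length (upTo (suc d))             ∎
      where open ≡-Reasoning

  neighbourSum-identity : ∀ {u v} → Adj G u v → ∃ λ m →
    neighbourSum G (relabel w c) u v + (w m + w (c u v) * 2)
      ≡ labelSum G (relabel w c) u + sum (map w (upTo (suc d)))
  neighbourSum-identity {u} {v} uv with m , missing ← missing-colour v = m , (begin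
    S u v + S v u + (w m + w (c u v) * 2)
      ≡⟨ regroup (S u v) (S v u) (w (c u v)) (w m) ⟩
    (S u v + w (c u v)) + (S v u + w (c u v) + w m)
      ≡⟨ cong (λ x → S u v + w (c u v) + (S v u + w x + w m)) (c-sym u v uv) ⟩
    (S u v + w (c u v)) + (S v u + w (c v u) + w m)
      ≡⟨ cong₂ (λ x y → x + (y + w m)) (sumAtExcept+label≡labelSum G g uv)
                                       (sumAtExcept+label≡labelSum G g vu) ⟩
    labelSum G g u + (labelSum G g v + w m)
      ≡⟨ cong (labelSum G g u +_) missing ⟩
    labelSum G g u + sum (map w (upTo (suc d))) ∎)
    where
    open ≡-Reasoning
    g : Labelling n
    g = relabel w c
    S : Fin n → Fin n → ℕ
    S = sumAtExcept G g
    vu : Adj G v u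
    vu = trans (SimpleGraph.sym G v u) uv
    regroup : ∀ p q r s → p + q + (s + r * 2) ≡ (p + r) + (q + r + s)
    regroup = solve-∀

  module _ (w-sep : Separating (suc d) w) where

    relabel-proper : Proper G (relabel w c)
    relabel-proper u v v′ uv uv′ v≢v′ eq =
      c-proper u v v′ uv uv′ v≢v′
        (w-sep (c<1+d u v uv) (c<1+d u v′ uv′) (cong (λ x → w 0 + x * 2) eq))

    relabel-additive : Additive G (relabel w c)
    relabel-additive u v v′ uv uv′ v≢v′ eq
      with m , identity ← neighbourSum-identity uv | m′ , identity′ ← neighbourSum-identity uv′ =
      c-proper u v v′ uv uv′ v≢v′ (w-sep (c<1+d u v uv) (c<1+d u v′ uv′)
        (+-cancelˡ-≡ (neighbourSum G (relabel w c) u v) _ _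
          (trans identity (trans (sym identity′) (cong (_+ (w m′ + w (c u v′) * 2)) (sym eq))))))

properAdditive≤bound : ∀ {n} (G : SimpleGraph n) {d} → Regular G d →
                       HasProperEdgeColouring G (suc d) →
                       HasProperAdditiveColouring G (bound (suc d))
properAdditive≤bound G {d} regular (c , c-sym , c-range , c-proper) =
  relabel w c₀ , (λ u v uv → cong w (c₀-sym u v uv)) , (λ u v _ → s≤s z≤n , suc-spread≤ K _) ,
  relabel-proper G regular c₀-sym c₀<1+d c₀-proper w w-sep ,
  relabel-additive G regular c₀-sym c₀<1+d c₀-proper w w-sep
  where
  K : ℕ
  K = ⌈log₂ suc d ⌉
  w : ℕ → ℕ
  w = suc ∘ spread K
  w-sep : Separating (suc d) w
  w-sep = Separating-suc {w = spread K}
            (Separating-antimono {w = spread K} (n≤2^⌈log₂n⌉ (suc d)) (spread-separating K))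
  c₀ : Labelling _
  c₀ = relabel (_∸ 1) c
  c₀-sym : WellDefined G c₀
  c₀-sym u v uv = cong (_∸ 1) (c-sym u v uv)
  c₀<1+d : ∀ u v → Adj G u v → c₀ u v < suc d
  c₀<1+d u v uv = s≤s (∸-monoˡ-≤ 1 (proj₂ (c-range u v uv)))
  c₀-proper : Proper G c₀
  c₀-proper u v v′ uv uv′ v≢v′ eq =
    c-proper u v v′ uv uv′ v≢v′ (∸-cancelʳ-≡ (proj₁ (c-range u v uv)) (proj₁ (c-range u v′ uv′)) eq)

bound-2^ : ∀ {k} m → k ≡ 2 ^ m → bound k ≡ (k ^ 2 + 2) / 3
bound-2^ m refl = cong (λ e → ((2 ^ e) ^ 2 + 2) / 3) (⌈log₂2^n⌉≡n m)

-- Only the existence of a (d+1)-edge-colouring is used, not the minimality of χ′(G) or m > 0.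
theorem2p4 : ∀ {n : ℕ} (G : SimpleGraph n) (d : ℕ) →
    Regular G d → ChromaticIndex G (suc d) →
    HasProperAdditiveColouring G (bound (suc d))
    × (∀ (m : ℕ) → 0 < m → suc d ≡ 2 ^ m →
        HasProperAdditiveColouring G ((suc d ^ 2 + 2) / 3))
theorem2p4 G d regular (colouring , _) =
  η′≤bound , λ m _ 1+d≡2^m → subst (HasProperAdditiveColouring G) (bound-2^ m 1+d≡2^m) η′≤bound
  where
  η′≤bound : HasProperAdditiveColouring G (bound (suc d))
  η′≤bound = properAdditive≤bound G regular colouring
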